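{- If $T$ is a tree and $S$ is a subtree of $T$, then $\zeta_1(S)\le\zeta_1(T)$.
   Context: All graphs are finite, connected, and without multiple edges. For a vertex $x$, $N(x)$ is its set of neighbours ($x\notin N(x)$) and $N[x]=N(x)\cup\{x\}$. The one-visibility Localization game with $k$ cops on a graph $G$: the robber first chooses a starting vertex; then in each round the cops choose (probe) vertices $u_1,\dots,u_k$ of $G$ (any vertices), and for each $i$ the probe returns $0$ if the robber is on $u_i$, $1$ if the robber is adjacent to $u_i$, and $\ast$ otherwise; then the robber moves to a vertex of $N[v]$, where $v$ is its current vertex. The cops win if after finitely many rounds the information obtained determines the robber's current vertex uniquely; the robber is omniscient. $\zeta_1(G)$ is the least positive integer $k$ such that $k$ cops have a winning strategy. A subtree of $T$ is a connected subgraph of $T$. -}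

module Defs where

open import Data.Nat using (ℕ; zero; suc; _≤_; _<_)
open import Data.Fin using (Fin; _≟_)
open import Data.Bool using (Bool; true; false)
open import Data.List using (List; []; _∷_; _++_; length)
open import Data.List.Relation.Unary.Unique.Propositional using (Unique)
open import Data.Vec using (Vec)
import Data.Vec as Vec
open import Data.Product using (Σ; ∃; _×_)
open import Data.Sum using (_⊎_)
open import Data.Unit using (⊤)
open import Relation.Nullary using (¬_; yes; no)
open import Relation.Binary.PropositionalEquality using (_≡_)
open import Function.Definitions using (Injective)

record Graph : Set where
  field
    n     : ℕ
    adj   : Fin n → Fin n → Bool
    sym   : ∀ x y → adj x y ≡ adj y x
    irref : ∀ x → adj x x ≡ false

open Graph public

Vertex : Graph → Set
Vertex G = Fin (n G)

Adj : (G : Graph) → Vertex G → Vertex G → Set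
Adj G x y = adj G x y ≡ true

data Walk (G : Graph) : Vertex G → Vertex G → Set where
  here : ∀ {x} → Walk G x x
  step : ∀ {x y z} → Adj G x y → Walk G y z → Walk G x z

Connected : Graph → Set
Connected G = ∀ x y → Walk G x y

Chain : (G : Graph) → List (Vertex G) → Set
Chain G []           = ⊤
Chain G (x ∷ [])     = ⊤
Chain G (x ∷ y ∷ vs) = Adj G x y × Chain G (y ∷ vs)

-- a cycle x, v₁, …, vₘ, y (m ≥ 1, so at least 3 distinct vertices),
-- consecutive vertices adjacent and y adjacent to x
HasCycle : Graph → Set
HasCycle G =
  Σ (Vertex G) λ x → Σ (List (Vertex G)) λ vs → Σ (Vertex G) λ y →
    (1 ≤ length vs) × Unique (x ∷ vs ++ y ∷ []) ×
    Chain G (x ∷ vs ++ y ∷ []) × Adj G y x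

IsTree : Graph → Set
IsTree T = Connected T × ¬ HasCycle T

IsSubgraph : Graph → Graph → Set
IsSubgraph S T =
  Σ (Vertex S → Vertex T) λ f →
    Injective _≡_ _≡_ f × (∀ x y → Adj S x y → Adj T (f x) (f y))

IsSubtree : Graph → Graph → Set
IsSubtree S T = IsSubgraph S T × Connected S

data Resp : Set where
  zeroR : Resp
  oneR  : Resp
  starR : Resp

probe : (G : Graph) → Vertex G → Vertex G → Resp
probe G u r with u ≟ r
... | yes _ = zeroR
... | no _ with adj G u r
...   | true  = oneR
...   | false = starR

-- history of responses, most recent round first
History : ℕ → Set
History k = List (Vec Resp k)

Strategy : Graph → ℕ → Set
Strategy G k = History k → Vec (Vertex G) k

-- robber trajectory: r i is the robber's vertex when the probes of round i
-- are made; it then moves to a vertex of N[r i]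
IsRobberWalk : (G : Graph) → (ℕ → Vertex G) → Set
IsRobberWalk G r = ∀ i → (r (suc i) ≡ r i) ⊎ Adj G (r i) (r (suc i))

history : (G : Graph) {k : ℕ} → Strategy G k → (ℕ → Vertex G) → ℕ → History k
history G σ r zero    = []
history G σ r (suc t) =
  Vec.map (λ u → probe G u (r t)) (σ (history G σ r t)) ∷ history G σ r t

-- k cops win: some strategy such that against every robber trajectory,
-- after some round t the information obtained (the responses of rounds
-- 0..t, which also determine the probes made) determines the robber's
-- current vertex r t uniquely.
CopsWin : Graph → ℕ → Set
CopsWin G k =
  Σ (Strategy G k) λ σ →
    ∀ r → IsRobberWalk G r →
      ∃ λ t → ∀ r′ → IsRobberWalk G r′ →
        history G σ r′ (suc t) ≡ history G σ r (suc t) → r′ t ≡ r t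

IsZeta1 : Graph → ℕ → Set
IsZeta1 G k = (1 ≤ k) × CopsWin G k × (∀ j → 1 ≤ j → j < k → ¬ CopsWin G j)

-- Cops on a tree T can be simulated by the same number of cops on a
-- subtree S.  Since S is connected and T has no cycle, S is an induced
-- subgraph of T, and every vertex u of T outside S has at most one
-- neighbour x in S.  A probe at u therefore carries no more information
-- about a robber confined to S than a probe at x (or at S itself, when
-- u ∈ S): the answer at u is a fixed function of the answer at x.  So a
-- winning strategy on T, played against the image of a robber walk in S,
-- yields a winning strategy on S, and ζ₁(S) ≤ ζ₁(T).
module Submission where

open import Defs hiding (sym)
open import Data.Nat using (ℕ; zero; suc; _≤_; s≤s; z≤n)
open import Data.Nat.Properties using (≮⇒≥)
open import Data.Fin using (_≟_)
open import Data.Fin.Properties using (any?)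
open import Data.Bool using (Bool; true; false)
import Data.Bool as Bool
open import Data.Bool.Properties using (⇔→≡; ¬-not; not-¬)
open import Data.List using (List; []; _∷_; _++_; map)
open import Data.List.Relation.Unary.Any using (here; there)
open import Data.List.Relation.Unary.All using ([])
open import Data.List.Relation.Unary.All.Properties.Core using (¬Any⇒All¬)
open import Data.List.Relation.Unary.AllPairs using ([]; _∷_)
open import Data.List.Relation.Unary.Unique.Propositional using (Unique)
open import Data.List.Membership.Propositional using (_∈_; _∉_)
open import Data.List.Membership.Propositional.Properties using (∈-map⁻)
open import Data.Vec using (Vec; []; _∷_)
import Data.Vec as Vec
open import Data.Product using (∃; _,_)
import Data.Sum as Sum
open import Data.Unit using (tt)
open import Data.Empty using (⊥-elim)
open import Function using (_∘_; id; const)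
open import Function.Bundles using (mk⇔)
open import Function.Definitions using (Injective)
open import Relation.Nullary using (¬_; Dec; yes; no)
open import Relation.Binary.PropositionalEquality
  using (_≡_; _≢_; refl; sym; trans; cong; cong₂; subst; module ≡-Reasoning)

adjResp : Bool → Resp
adjResp true  = oneR
adjResp false = starR

module _ (G : Graph) where

  probe-≡ : ∀ {u r} → u ≡ r → probe G u r ≡ zeroR
  probe-≡ {u} {r} u≡r with u ≟ r
  ... | yes _   = refl
  ... | no u≢r = ⊥-elim (u≢r u≡r)

  probe-≢ : ∀ {u r} → u ≢ r → probe G u r ≡ adjResp (adj G u r)
  probe-≢ {u} {r} u≢r with u ≟ r
  ... | yes u≡r = ⊥-elim (u≢r u≡r)
  ... | no _ with adj G u r
  ...   | true  = refl
  ...   | false = refl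

-- The answer a probe at u would give, computed from the answer at the
-- unique neighbour of u in the subgraph.
neighbourResp : Resp → Resp
neighbourResp zeroR = oneR
neighbourResp _     = starR

module ProbeTranslation {S T : Graph} (f : Vertex S → Vertex T)
                        (f-injective : Injective _≡_ _≡_ f) where

  probe-image : (∀ x y → adj T (f x) (f y) ≡ adj S x y) →
                ∀ x r → probe T (f x) (f r) ≡ probe S x r
  probe-image adj-f x r = by-cases (x ≟ r)
    where
    open ≡-Reasoning
    by-cases : Dec (x ≡ r) → probe T (f x) (f r) ≡ probe S x r
    by-cases (yes x≡r) = trans (probe-≡ T (cong f x≡r)) (sym (probe-≡ S x≡r))
    by-cases (no x≢r) = begin
      probe T (f x) (f r)         ≡⟨ probe-≢ T (x≢r ∘ f-injective) ⟩
      adjResp (adj T (f x) (f r)) ≡⟨ cong adjResp (adj-f x r) ⟩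
      adjResp (adj S x r)         ≡⟨ sym (probe-≢ S x≢r) ⟩
      probe S x r                 ∎

  probe-beside : ∀ {u x} → (∀ z → f z ≢ u) →
                 (∀ {y z} → Adj T u (f y) → Adj T u (f z) → y ≡ z) →
                 Adj T u (f x) → ∀ r → probe T u (f r) ≡ neighbourResp (probe S x r)
  probe-beside {u} {x} u∉f unique ux r = by-cases (x ≟ r)
    where
    open ≡-Reasoning
    neighbourResp-adjResp : ∀ b → starR ≡ neighbourResp (adjResp b)
    neighbourResp-adjResp true  = refl
    neighbourResp-adjResp false = refl

    by-cases : Dec (x ≡ r) → probe T u (f r) ≡ neighbourResp (probe S x r)
    by-cases (yes x≡r) = begin
      probe T u (f r)             ≡⟨ probe-≢ T (u∉f r ∘ sym) ⟩
      adjResp (adj T u (f r))     ≡⟨ cong adjResp (subst (Adj T u ∘ f) x≡r ux) ⟩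
      neighbourResp zeroR         ≡⟨ cong neighbourResp (sym (probe-≡ S x≡r)) ⟩
      neighbourResp (probe S x r) ∎
    by-cases (no x≢r) = begin
      probe T u (f r)                     ≡⟨ probe-≢ T (u∉f r ∘ sym) ⟩
      adjResp (adj T u (f r))             ≡⟨ cong adjResp (¬-not (x≢r ∘ unique ux)) ⟩
      starR                               ≡⟨ neighbourResp-adjResp (adj S x r) ⟩
      neighbourResp (adjResp (adj S x r)) ≡⟨ cong neighbourResp (sym (probe-≢ S x≢r)) ⟩
      neighbourResp (probe S x r)         ∎

  probe-away : ∀ {u} → (∀ z → f z ≢ u) → (∀ z → ¬ Adj T u (f z)) →
               ∀ r → probe T u (f r) ≡ starR
  probe-away u∉f u≁f r =
    trans (probe-≢ T (u∉f r ∘ sym)) (cong adjResp (¬-not (u≁f r)))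

-- A path from x to z is indexed by the list of its vertices after x.
data Path (G : Graph) : Vertex G → Vertex G → List (Vertex G) → Set where
  nil  : ∀ {x} → Path G x x []
  cons : ∀ {x y z L} → Adj G x y → Path G y z L → x ∉ y ∷ L → Path G x z (y ∷ L)

module _ {G : Graph} where
  open import Data.List.Membership.DecPropositional (_≟_ {n G}) using (_∈?_)

  path-unique : ∀ {x z L} → Path G x z L → Unique (x ∷ L)
  path-unique nil          = [] ∷ []
  path-unique (cons _ p x∉) = ¬Any⇒All¬ _ x∉ ∷ path-unique p

  path-chain : ∀ {x z L} → Path G x z L → Chain G (x ∷ L)
  path-chain nil          = tt
  path-chain (cons xy p _) = xy , path-chain p

  path-last : ∀ {x z L} → Path G x z L → ∃ λ M → x ∷ L ≡ M ++ z ∷ []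
  path-last nil = [] , refl
  path-last {x} (cons _ p _) with path-last p
  ... | M , eq = x ∷ M , cong (x ∷_) eq

  path-suffix : ∀ {x y z L} → Path G y z L → x ∈ y ∷ L → ∃ (Path G x z)
  path-suffix p            (here refl) = _ , p
  path-suffix (cons _ p _) (there x∈)  = path-suffix p x∈

  walk⇒path : ∀ {x z} → Walk G x z → ∃ (Path G x z)
  walk⇒path here = _ , nil
  walk⇒path {x} (step xy w) with walk⇒path w
  ... | L , p with x ∈? _ ∷ L
  ...   | yes x∈ = path-suffix p x∈
  ...   | no x∉  = _ , cons xy p x∉

  closed-path⇒cycle : ∀ {x z w v L} → Path G x z (w ∷ v ∷ L) → Adj G z x → HasCycle G
  closed-path⇒cycle {x} {z} {w} p@(cons _ (cons _ q _) _) zx with path-last q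
  ... | M , eq = x , w ∷ M , z , s≤s z≤n
                 , subst (λ K → Unique (x ∷ w ∷ K)) eq (path-unique p)
                 , subst (λ K → Chain G (x ∷ w ∷ K)) eq (path-chain p)
                 , zx

module _ {S T : Graph} {f : Vertex S → Vertex T} (f-injective : Injective _≡_ _≡_ f)
         (f-adj : ∀ x y → Adj S x y → Adj T (f x) (f y)) where

  path-map : ∀ {x z L} → Path S x z L → Path T (f x) (f z) (map f L)
  path-map nil           = nil
  path-map (cons xy p x∉) = cons (f-adj _ _ xy) (path-map p) (x∉ ∘ preimage)
    where
    preimage : ∀ {x L} → f x ∈ map f L → x ∈ L
    preimage fx∈ with ∈-map⁻ f fx∈
    ... | y , y∈ , fx≡fy = subst (_∈ _) (sym (f-injective fx≡fy)) y∈

module ConnectedSubgraph {S T : Graph} {f : Vertex S → Vertex T}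
                         (f-injective : Injective _≡_ _≡_ f)
                         (f-adj : ∀ x y → Adj S x y → Adj T (f x) (f y))
                         (T-acyclic : ¬ HasCycle T) (S-connected : Connected S) where

  adj-reflected : ∀ x y → Adj T (f x) (f y) → Adj S x y
  adj-reflected x y fxy with walk⇒path (S-connected x y)
  ... | _ , nil = ⊥-elim (not-¬ (irref T (f x)) fxy)
  ... | _ , cons xy nil _ = xy
  ... | _ , p@(cons _ (cons _ _ _) _) =
    ⊥-elim (T-acyclic (closed-path⇒cycle (path-map f-injective f-adj p)
                                          (trans (Graph.sym T (f y) (f x)) fxy)))

  adj-image : ∀ x y → adj T (f x) (f y) ≡ adj S x y
  adj-image x y = ⇔→≡ (mk⇔ (adj-reflected x y) (f-adj x y))

  neighbour-unique : ∀ {u} → (∀ z → f z ≢ u) →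
                     ∀ {x r} → Adj T u (f x) → Adj T u (f r) → x ≡ r
  neighbour-unique {u} u∉f {x} {r} ux ur with walk⇒path (S-connected x r)
  ... | _ , nil = refl
  ... | _ , p@(cons _ _ _) =
    ⊥-elim (T-acyclic (closed-path⇒cycle (cons ux (path-map f-injective f-adj p) u∉map)
                                          (trans (Graph.sym T (f r) u) ur)))
    where
    u∉map : ∀ {L} → u ∉ map f L
    u∉map u∈ with ∈-map⁻ f u∈
    ... | z , _ , u≡fz = u∉f z (sym u≡fz)

record ProbeSimulation (S T : Graph) (f : Vertex S → Vertex T) : Set where
  field
    proxy     : Vertex T → Vertex S
    translate : Vertex T → Resp → Resp
    simulates : ∀ u r → probe T u (f r) ≡ translate u (probe S (proxy u) r)

module Positions {S T : Graph} (f : Vertex S → Vertex T) where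

  data Position (u : Vertex T) : Set where
    image  : ∀ x → f x ≡ u → Position u
    beside : ∀ x → (∀ z → f z ≢ u) → Adj T u (f x) → Position u
    away   : (∀ z → f z ≢ u) → (∀ z → ¬ Adj T u (f z)) → Position u

  position : ∀ u → Position u
  position u with any? (λ x → f x ≟ u)
  ... | yes (x , fx≡u) = image x fx≡u
  ... | no ∄x with any? (λ x → adj T u (f x) Bool.≟ true)
  ...   | yes (x , ux) = beside x (λ z fz≡u → ∄x (z , fz≡u)) ux
  ...   | no ∄y        = away (λ z fz≡u → ∄x (z , fz≡u)) (λ z uz → ∄y (z , uz))

subtree-simulation : ∀ {S T} {f : Vertex S → Vertex T} →
                     Injective _≡_ _≡_ f → (∀ x y → Adj S x y → Adj T (f x) (f y)) →
                     ¬ HasCycle T → Connected S → Vertex S → ProbeSimulation S T f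
subtree-simulation {S} {T} {f} f-injective f-adj T-acyclic S-connected default = record
  { proxy     = proxyAt ∘ position
  ; translate = translateAt ∘ position
  ; simulates = λ u → simulatesAt (position u)
  }
  where
  open Positions {S} {T} f
  open ProbeTranslation {S} {T} f f-injective
  open ConnectedSubgraph {S} {T} f-injective f-adj T-acyclic S-connected

  proxyAt : ∀ {u} → Position u → Vertex S
  proxyAt (image x _)    = x
  proxyAt (beside x _ _) = x
  proxyAt (away _ _)     = default

  translateAt : ∀ {u} → Position u → Resp → Resp
  translateAt (image _ _)    = id
  translateAt (beside _ _ _) = neighbourResp
  translateAt (away _ _)     = const starR

  simulatesAt : ∀ {u} (pos : Position u) r →
                probe T u (f r) ≡ translateAt pos (probe S (proxyAt pos) r)
  simulatesAt (image x refl)     = probe-image adj-image x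
  simulatesAt (beside x u∉f ux)  = probe-beside u∉f (neighbour-unique u∉f) ux
  simulatesAt (away u∉f u≁f) r   = probe-away u∉f u≁f r

module _ {S T : Graph} {f : Vertex S → Vertex T} (sim : ProbeSimulation S T f) where
  open ProbeSimulation sim

  module _ {k : ℕ} (σ : Strategy T k) where

    liftHistory : History k → History k
    liftHistory []       = []
    liftHistory (h ∷ hs) = Vec.zipWith translate (σ (liftHistory hs)) h ∷ liftHistory hs

    proxyStrategy : Strategy S k
    proxyStrategy = Vec.map proxy ∘ σ ∘ liftHistory

    translate-probes : ∀ {m} (us : Vec (Vertex T) m) r →
      Vec.zipWith translate us (Vec.map (λ v → probe S v r) (Vec.map proxy us))
        ≡ Vec.map (λ u → probe T u (f r)) us
    translate-probes []       r = refl
    translate-probes (u ∷ us) r = cong₂ _∷_ (sym (simulates u r)) (translate-probes us r)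

    liftHistory-history : ∀ r t →
      liftHistory (history S proxyStrategy r t) ≡ history T σ (f ∘ r) t
    liftHistory-history r zero = refl
    liftHistory-history r (suc t) rewrite liftHistory-history r t =
      cong (_∷ history T σ (f ∘ r) t) (translate-probes (σ (history T σ (f ∘ r) t)) (r t))

    history-lift : ∀ r r′ t → history S proxyStrategy r′ t ≡ history S proxyStrategy r t →
                   history T σ (f ∘ r′) t ≡ history T σ (f ∘ r) t
    history-lift r r′ t same = begin
      history T σ (f ∘ r′) t                    ≡⟨ sym (liftHistory-history r′ t) ⟩
      liftHistory (history S proxyStrategy r′ t) ≡⟨ cong liftHistory same ⟩
      liftHistory (history S proxyStrategy r t)  ≡⟨ liftHistory-history r t ⟩
      history T σ (f ∘ r) t                     ∎
      where open ≡-Reasoning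

  CopsWin-transfer : Injective _≡_ _≡_ f → (∀ x y → Adj S x y → Adj T (f x) (f y)) →
                     ∀ {k} → CopsWin T k → CopsWin S k
  CopsWin-transfer f-injective f-adj (σ , wins) = proxyStrategy σ , catch
    where
    walk-map : ∀ {r} → IsRobberWalk S r → IsRobberWalk T (f ∘ r)
    walk-map w i = Sum.map (cong f) (f-adj _ _) (w i)

    catch : ∀ r → IsRobberWalk S r → ∃ λ t → ∀ r′ → IsRobberWalk S r′ →
            history S (proxyStrategy σ) r′ (suc t) ≡ history S (proxyStrategy σ) r (suc t) →
            r′ t ≡ r t
    catch r w with wins (f ∘ r) (walk-map w)
    ... | t , located = t , λ r′ w′ same →
      f-injective (located (f ∘ r′) (walk-map w′) (history-lift σ r r′ (suc t) same))

CopsWin-vertex : ∀ {G k} → 1 ≤ k → CopsWin G k → Vertex G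
CopsWin-vertex (s≤s z≤n) (σ , _) = Vec.head (σ [])

mainTheorem20 : (T S : Graph) → IsTree T → IsSubtree S T →
    (a b : ℕ) → IsZeta1 S a → IsZeta1 T b → a ≤ b
mainTheorem20 T S (_ , T-acyclic) ((f , f-injective , f-adj) , S-connected) a b
              (1≤a , S-wins , S-minimal) (1≤b , T-wins , _) =
  ≮⇒≥ λ b<a → S-minimal b 1≤b b<a (CopsWin-transfer sim f-injective f-adj T-wins)
  where
  sim : ProbeSimulation S T f
  sim = subtree-simulation f-injective f-adj T-acyclic S-connected
                           (CopsWin-vertex 1≤a S-wins)
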